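{- For every integer $t\ge 0$ there is a constant $C_t$ such that the following holds for every integer $\ell\ge 1$. Let $P=x_1,\ldots,x_m$ be a path and let $G$ be a graph that is edge-maximal with respect to a width-$t$ $P$-decomposition $(B_x:x\in V(P))$ of $G$. Then there exists a set $U\subseteq V(G)$ such that (Z1) $B_{x_1}\cup B_{x_m}\subseteq U$; (Z2) $|U|\le C_t\,\ell^t$; and (Z3) for every non-trivial induced path $w_0,\ldots,w_q$ in $G$ of length $q\le\ell$ with $\{w_0,w_q\}\subseteq U$, we have $\{w_1,\ldots,w_{q-1}\}\subseteq U$.
   Context: A $P$-decomposition of $G$ is a sequence of bags $B_x\subseteq V(G)$, $x\in V(P)$, such that for each $v\in V(G)$ the nodes $x$ with $v\in B_x$ induce a connected subpath of $P$, and each edge of $G$ is contained in some bag; its width is $\max_x|B_x|-1$. $G$ is edge-maximal with respect to it if every bag induces a clique in $G$. A path is induced if it is an induced subgraph; its length is its number of edges. -}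

module Defs where

open import Data.Nat using (ℕ; zero; suc; _+_; _*_; _^_; _≤_; _<_)
open import Data.Fin using (Fin; toℕ; zero)
open import Data.Fin.Subset using (Subset; _∈_; _∪_; _⊆_; ∣_∣)
open import Data.Bool using (Bool; true; false)
open import Data.Product using (Σ; ∃; _×_; _,_)
open import Data.Sum using (_⊎_)
open import Relation.Binary.PropositionalEquality using (_≡_; _≢_)
open import Function.Bundles using (_⇔_)

record Graph (n : ℕ) : Set where
  field
    adj    : Fin n → Fin n → Bool
    sym    : ∀ u v → adj u v ≡ adj v u
    irrefl : ∀ v → adj v v ≡ false

open Graph public

Adj : ∀ {n} → Graph n → Fin n → Fin n → Set
Adj G u v = adj G u v ≡ true

-- A P-decomposition of G where P = x_1,...,x_m is the path on Fin m
-- (node i adjacent to node i+1). Bags are subsets of V(G).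
record IsPathDecomposition {n : ℕ} (G : Graph n) (m : ℕ) (B : Fin m → Subset n) : Set where
  field
    nonempty  : ∀ (v : Fin n) → ∃ λ (x : Fin m) → v ∈ B x
    connected : ∀ (v : Fin n) (i j k : Fin m) → toℕ i ≤ toℕ j → toℕ j ≤ toℕ k →
                v ∈ B i → v ∈ B k → v ∈ B j
    edges     : ∀ (u v : Fin n) → Adj G u v → ∃ λ (x : Fin m) → (u ∈ B x × v ∈ B x)

HasWidth : ∀ {n m : ℕ} → (Fin m → Subset n) → ℕ → Set
HasWidth {n} {m} B t = (∀ (x : Fin m) → ∣ B x ∣ ≤ suc t) × (∃ λ (x : Fin m) → ∣ B x ∣ ≡ suc t)

-- G is edge-maximal w.r.t. the decomposition: every bag induces a clique
EdgeMaximal : ∀ {n m : ℕ} → Graph n → (Fin m → Subset n) → Set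
EdgeMaximal {n} {m} G B = ∀ (x : Fin m) (u v : Fin n) → u ∈ B x → v ∈ B x → u ≢ v → Adj G u v

IsInducedPath : ∀ {n : ℕ} → Graph n → (q : ℕ) → (Fin (suc q) → Fin n) → Set
IsInducedPath {n} G q w =
  (∀ i j → w i ≡ w j → i ≡ j) ×
  (∀ i j → Adj G (w i) (w j) ⇔ (toℕ j ≡ suc (toℕ i) ⊎ toℕ i ≡ suc (toℕ j)))

module Submission where

-- A vertex is
-- inside the gap (g, g') if all its bags lie strictly between g and g'; a crossing of
-- (g, g') is a walk of length 2 … ℓ from β g ∖ β g' to β g' ∖ β g with inside interior.
-- (1) By edge-maximality, an induced path of length ≤ ℓ whose ends are not inside (g, g')
--     but which meets an inside vertex contains a crossing (crossing-from-path).
-- (2) The excess of a bag over (g, g') is the set of its vertices not in both β g and β g';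
--     it has at most t + 1 elements, and excess ≤ 1 everywhere rules out crossings.
-- (3) Greedy jumps from h (to the furthest bag sharing a vertex not spanning (h, h'))
--     either miss h' after ℓ + 1 jumps, and then (h, h') has no crossing, or make at most
--     ℓ intermediate stops, between any two of which the excess has dropped by one.
-- Recursing t times (refine) gives at most R t < (2ℓ)^t cut points such that every other
-- position lies in a crossing-free gap between consecutive cut points.  U is the union of
-- the bags at 0, m and the cut points: it has at most (R t + 2)(t + 1) vertices, and a
-- vertex of a short induced path with ends in U that is not in U would lie inside such a
-- gap while the ends do not, so by (1) the gap would have a crossing.

open import Defs hiding (sym)
open import Data.Nat using (ℕ; zero; suc; _+_; _*_; _∸_; _^_; _≤_; _<_; z≤n; s≤s; _≤?_; _<?_; _⊔_; _≟_)
open import Data.Nat.Properties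
open import Data.Fin using (Fin; toℕ; zero; fromℕ; fromℕ<)
open import Data.Fin.Properties using (toℕ-fromℕ<; fromℕ<-toℕ; toℕ≤pred[n]; any?; toℕ-injective; toℕ-fromℕ)
open import Data.Fin.Subset using (Subset; _∈_; _∉_; _∪_; _∩_; ∁; ⊥; _⊆_; ∣_∣; ⁅_⁆; ⋃; inside; outside)
open import Data.Fin.Subset.Properties using (_∈?_; ∉⊥; ∣⊥∣≡0; p⊂q⇒∣p∣<∣q∣; x∈p∩q⁺; x∈p∩q⁻; x∈∁p⇒x∉p; x∉p⇒x∈∁p; x∈⁅y⁆⇒x≡y; ∣⁅x⁆∣≡1; x∈p∪q⁺; x∈p∪q⁻; ∣p∩q∣≤∣p∣)
open import Data.Vec using (_∷_; [])
open import Data.List using (List; []; _∷_; _++_; length; map)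
open import Data.List.Membership.Propositional using () renaming (_∈_ to _∈ₗ_; _∉_ to _∉ₗ_)
open import Data.List.Relation.Unary.Any using (here; there)
open import Data.List.Membership.Propositional.Properties using (∈-++⁺ˡ; ∈-++⁺ʳ; ∈-++⁻)
open import Data.List.Properties using (length-++)
open import Relation.Binary.Definitions using (tri<; tri≈; tri>)
open import Data.Nat.Tactic.RingSolver using (solve-∀)
open import Data.Product using (∃; Σ; _×_; _,_; proj₁; proj₂)
open import Data.Sum using (_⊎_; inj₁; inj₂)
import Data.Sum as Sum
open import Data.Empty using (⊥-elim)
open import Data.Maybe using (Maybe; just; nothing)
import Data.Maybe as Maybe
open import Relation.Nullary using (¬_; yes; no; contradiction)
open import Relation.Nullary.Decidable using (_×-dec_; ¬?)
open import Relation.Unary using (Decidable)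
open import Function.Bundles using (Equivalence)
open import Relation.Binary.PropositionalEquality using (_≡_; _≢_; refl; sym; trans; cong; subst; subst₂)

∣p∪q∣≤∣p∣+∣q∣ : ∀ {n} (p q : Subset n) → ∣ p ∪ q ∣ ≤ ∣ p ∣ + ∣ q ∣
∣p∪q∣≤∣p∣+∣q∣ [] [] = z≤n
∣p∪q∣≤∣p∣+∣q∣ (outside ∷ p) (outside ∷ q) = ∣p∪q∣≤∣p∣+∣q∣ p q
∣p∪q∣≤∣p∣+∣q∣ (outside ∷ p) (inside ∷ q) =
  ≤-trans (s≤s (∣p∪q∣≤∣p∣+∣q∣ p q)) (≤-reflexive (sym (+-suc ∣ p ∣ ∣ q ∣)))
∣p∪q∣≤∣p∣+∣q∣ (inside ∷ p) (outside ∷ q) = s≤s (∣p∪q∣≤∣p∣+∣q∣ p q)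
∣p∪q∣≤∣p∣+∣q∣ (inside ∷ p) (inside ∷ q) =
  s≤s (≤-trans (∣p∪q∣≤∣p∣+∣q∣ p q) (+-monoʳ-≤ ∣ p ∣ (n≤1+n ∣ q ∣)))

two-elements : ∀ {n} {S : Subset n} {a b : Fin n} → a ∈ S → b ∈ S → a ≢ b → 1 < ∣ S ∣
two-elements {S = S} {a} {b} a∈S b∈S a≢b =
  subst (_< ∣ S ∣) (∣⁅x⁆∣≡1 a) (p⊂q⇒∣p∣<∣q∣ (⁅a⁆⊆S , b , b∈S , b∉⁅a⁆))
  where
    ⁅a⁆⊆S : ⁅ a ⁆ ⊆ S
    ⁅a⁆⊆S x∈⁅a⁆ = subst (_∈ S) (sym (x∈⁅y⁆⇒x≡y a x∈⁅a⁆)) a∈S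
    b∉⁅a⁆ : b ∉ ⁅ a ⁆
    b∉⁅a⁆ b∈⁅a⁆ = a≢b (sym (x∈⁅y⁆⇒x≡y a b∈⁅a⁆))

module _ {n : ℕ} {A : Set} (f : A → Subset n) where

  ∈-⋃-map⁺ : ∀ {x v} xs → x ∈ₗ xs → v ∈ f x → v ∈ ⋃ (map f xs)
  ∈-⋃-map⁺ (_ ∷ xs) (here refl) v∈ = x∈p∪q⁺ (inj₁ v∈)
  ∈-⋃-map⁺ (_ ∷ xs) (there x∈) v∈ = x∈p∪q⁺ (inj₂ (∈-⋃-map⁺ xs x∈ v∈))

  ∈-⋃-map⁻ : ∀ {v} xs → v ∈ ⋃ (map f xs) → ∃ λ x → x ∈ₗ xs × v ∈ f x
  ∈-⋃-map⁻ [] v∈ = ⊥-elim (∉⊥ v∈)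
  ∈-⋃-map⁻ (x ∷ xs) v∈ with x∈p∪q⁻ (f x) (⋃ (map f xs)) v∈
  ... | inj₁ v∈fx = x , here refl , v∈fx
  ... | inj₂ v∈⋃ = let (y , y∈ , v∈fy) = ∈-⋃-map⁻ xs v∈⋃ in y , there y∈ , v∈fy

  ∣⋃-map∣≤ : ∀ {k} → (∀ x → ∣ f x ∣ ≤ k) → ∀ xs → ∣ ⋃ (map f xs) ∣ ≤ length xs * k
  ∣⋃-map∣≤ bound [] = ≤-reflexive (∣⊥∣≡0 n)
  ∣⋃-map∣≤ bound (x ∷ xs) =
    ≤-trans (∣p∪q∣≤∣p∣+∣q∣ (f x) _) (+-mono-≤ (bound x) (∣⋃-map∣≤ bound xs))

-- The largest number in (x, top] satisfying a decidable predicate P, or x if there is none.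
module Largest {P : ℕ → Set} (P? : Decidable P) where

  largest : ℕ → ℕ → ℕ
  largest x zero = x
  largest x (suc d) with x <? suc d | P? (suc d)
  ... | yes _ | yes _ = suc d
  ... | _ | _ = largest x d

  x≤largest : ∀ x top → x ≤ largest x top
  x≤largest x zero = ≤-refl
  x≤largest x (suc d) with x <? suc d | P? (suc d)
  ... | yes x<d | yes _ = <⇒≤ x<d
  ... | yes _ | no _ = x≤largest x d
  ... | no _ | _ = x≤largest x d

  largest≤x⊔top : ∀ x top → largest x top ≤ x ⊔ top
  largest≤x⊔top x zero = m≤m⊔n x 0
  largest≤x⊔top x (suc d) with x <? suc d | P? (suc d)
  ... | yes _ | yes _ = m≤n⊔m x (suc d)
  ... | yes _ | no _ = ≤-trans (largest≤x⊔top x d) (⊔-monoʳ-≤ x (n≤1+n d))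
  ... | no _ | _ = ≤-trans (largest≤x⊔top x d) (⊔-monoʳ-≤ x (n≤1+n d))

  largest≤top : ∀ x top → x ≤ top → largest x top ≤ top
  largest≤top x top x≤top = subst (largest x top ≤_) (m≤n⇒m⊔n≡n x≤top) (largest≤x⊔top x top)

  largest-maximal : ∀ x top p → x ≤ p → p ≤ top → P p → p ≤ largest x top
  largest-maximal x zero p _ p≤0 _ = ≤-trans p≤0 z≤n
  largest-maximal x (suc d) p x≤p p≤top Pp with x <? suc d | P? (suc d)
  ... | yes _ | yes _ = p≤top
  ... | no x≮d | _ = ≤-trans p≤top (≤-trans (≮⇒≥ x≮d) (x≤largest x d))
  ... | yes _ | no ¬Pd with m≤n⇒m<n∨m≡n p≤top
  ...   | inj₁ p<top = largest-maximal x d p x≤p (≤-pred p<top) Pp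
  ...   | inj₂ refl = contradiction Pp ¬Pd

  largest-satisfies : ∀ x top → largest x top ≢ x → P (largest x top)
  largest-satisfies x zero ≢x = contradiction refl ≢x
  largest-satisfies x (suc d) ≢x with x <? suc d | P? (suc d)
  ... | yes _ | yes Pd = Pd
  ... | yes _ | no _ = largest-satisfies x d ≢x
  ... | no _ | _ = largest-satisfies x d ≢x

module Runs {Q : ℕ → Set} (Q? : Decidable Q) where

  last-failure-below : ∀ i → ¬ Q 0 → Q i →
    ∃ λ j → j < i × ¬ Q j × (∀ c → j < c → c ≤ i → Q c)
  last-failure-below zero ¬Q0 Qi = contradiction Qi ¬Q0
  last-failure-below (suc i) ¬Q0 Qsi with Q? i
  ... | no ¬Qi = i , ≤-refl , ¬Qi , λ c i<c c≤si → subst Q (≤-antisym i<c c≤si) Qsi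
  ... | yes Qi with last-failure-below i ¬Q0 Qi
  ...   | j , j<i , ¬Qj , run = j , m<n⇒m<1+n j<i , ¬Qj , extend
    where
      extend : ∀ c → j < c → c ≤ suc i → Q c
      extend c j<c c≤si with m≤n⇒m<n∨m≡n c≤si
      ... | inj₁ c<si = run c j<c (≤-pred c<si)
      ... | inj₂ refl = Qsi

  first-failure-above : ∀ d i → Q i → ¬ Q (d + i) →
    ∃ λ k → i < k × k ≤ d + i × ¬ Q k × (∀ c → i ≤ c → c < k → Q c)
  first-failure-above zero i Qi ¬Qi = contradiction Qi ¬Qi
  first-failure-above (suc d) i Qi ¬Qend with Q? (suc i)
  ... | no ¬Qsi = suc i , ≤-refl , s≤s (m≤n+m i d) , ¬Qsi ,
                  λ c i≤c c<si → subst Q (≤-antisym i≤c (≤-pred c<si)) Qi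
  ... | yes Qsi with first-failure-above d (suc i) Qsi (subst (λ z → ¬ Q z) (sym (+-suc d i)) ¬Qend)
  ...   | k , si<k , k≤end , ¬Qk , run =
          k , <-trans (n<1+n i) si<k , ≤-trans k≤end (≤-reflexive (+-suc d i)) , ¬Qk , extend
    where
      extend : ∀ c → i ≤ c → c < k → Q c
      extend c i≤c c<k with m≤n⇒m<n∨m≡n i≤c
      ... | inj₁ i<c = run c i<c c<k
      ... | inj₂ refl = Qi

  record MaximalRun (q i : ℕ) : Set where
    field
      j r : ℕ
      j<i : j < i
      i<r+j : i < r + j
      r+j≤q : r + j ≤ q
      fails-left : ¬ Q j
      fails-right : ¬ Q (r + j)
      holds : ∀ c → 0 < c → c < r → Q (c + j)

  maximal-run : ∀ {q i} → i ≤ q → ¬ Q 0 → ¬ Q q → Q i → MaximalRun q i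
  maximal-run {q} {i} i≤q ¬Q0 ¬Qq Qi with last-failure-below i ¬Q0 Qi
      | first-failure-above (q ∸ i) i Qi (subst (λ z → ¬ Q z) (sym (m∸n+n≡m i≤q)) ¬Qq)
  ... | j , j<i , ¬Qj , left | k , i<k , k≤q , ¬Qk , right = record
    { j = j ; r = k ∸ j ; j<i = j<i
    ; i<r+j = subst (i <_) (sym r+j≡k) i<k
    ; r+j≤q = subst (_≤ q) (sym r+j≡k) (≤-trans k≤q (≤-reflexive (m∸n+n≡m i≤q)))
    ; fails-left = ¬Qj
    ; fails-right = subst (λ z → ¬ Q z) (sym r+j≡k) ¬Qk
    ; holds = λ c 0<c c<r → between (c + j) (subst (_< c + j) (+-identityˡ j) (+-monoˡ-< j 0<c))
                               (subst (c + j <_) r+j≡k (+-monoˡ-< j c<r))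
    }
    where
      r+j≡k : k ∸ j + j ≡ k
      r+j≡k = m∸n+n≡m (<⇒≤ (<-trans j<i i<k))
      between : ∀ c → j < c → c < k → Q c
      between c j<c c<k with c ≤? i
      ... | yes c≤i = left c j<c c≤i
      ... | no c≰i = right c (<⇒≤ (≰⇒> c≰i)) c<k

Adj-sym : ∀ {n} (G : Graph n) {u v : Fin n} → Adj G u v → Adj G v u
Adj-sym G {u} {v} uv = trans (Graph.sym G v u) uv

IsWalk : ∀ {n} → Graph n → ℕ → (ℕ → Fin n) → Set
IsWalk G r u = ∀ c → c < r → Adj G (u c) (u (suc c))

r∸c≡1+r∸[1+c] : ∀ {r c} → c < r → r ∸ c ≡ suc (r ∸ suc c)
r∸c≡1+r∸[1+c] {suc r} {zero} _ = refl
r∸c≡1+r∸[1+c] {suc r} {suc c} (s≤s c<r) = r∸c≡1+r∸[1+c] c<r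

reverse-walk : ∀ {n} (G : Graph n) {r u} → IsWalk G r u → IsWalk G r (λ c → u (r ∸ c))
reverse-walk G {r} {u} walk c c<r =
  subst (λ z → Adj G (u z) (u (r ∸ suc c))) (sym (r∸c≡1+r∸[1+c] c<r))
    (Adj-sym G (walk (r ∸ suc c) (∸-monoʳ-< (s≤s z≤n) c<r)))

record IsInducedWalk {n} (G : Graph n) (q : ℕ) (W : ℕ → Fin n) : Set where
  field
    walk : IsWalk G q W
    injective : ∀ a b → a ≤ q → b ≤ q → W a ≡ W b → a ≡ b
    chordless : ∀ a b → a ≤ q → b ≤ q → Adj G (W a) (W b) → b ≡ suc a ⊎ a ≡ suc b

-- Natural-number positions in Fin (suc q); positions beyond q are sent to 0.
toFin : ∀ q → ℕ → Fin (suc q)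
toFin q a with a ≤? q
... | yes a≤q = fromℕ< (s≤s a≤q)
... | no _ = zero

toℕ-toFin : ∀ {q a} → a ≤ q → toℕ (toFin q a) ≡ a
toℕ-toFin {q} {a} a≤q with a ≤? q
... | yes _ = toℕ-fromℕ< (s≤s a≤q)
... | no a≰q = contradiction a≤q a≰q

toFin-toℕ : ∀ {q} (x : Fin (suc q)) → toFin q (toℕ x) ≡ x
toFin-toℕ x = toℕ-injective (toℕ-toFin (toℕ≤pred[n] x))

induced-walk : ∀ {n} {G : Graph n} {q w} → IsInducedPath G q w →
  IsInducedWalk G q (λ a → w (toFin q a))
induced-walk {G = G} {q} {w} (inj , adj⇔) = record
  { walk = λ a a<q → Equivalence.from (adj⇔ (toFin q a) (toFin q (suc a)))
             (inj₁ (trans (toℕ-toFin a<q) (cong suc (sym (toℕ-toFin (<⇒≤ a<q))))))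
  ; injective = λ a b a≤q b≤q eq → trans (sym (toℕ-toFin a≤q))
                  (trans (cong toℕ (inj _ _ eq)) (toℕ-toFin b≤q))
  ; chordless = chordless
  }
  where
    chordless : ∀ a b → a ≤ q → b ≤ q → Adj G (w (toFin q a)) (w (toFin q b)) →
      b ≡ suc a ⊎ a ≡ suc b
    chordless a b a≤q b≤q ab with Equivalence.to (adj⇔ (toFin q a) (toFin q b)) ab
    ... | inj₁ eq = inj₁ (trans (sym (toℕ-toFin b≤q)) (trans eq (cong suc (toℕ-toFin a≤q))))
    ... | inj₂ eq = inj₂ (trans (sym (toℕ-toFin a≤q)) (trans eq (cong suc (toℕ-toFin b≤q))))

module Decomposition {n m : ℕ} (G : Graph n) (B : Fin (suc m) → Subset n)
  (PD : IsPathDecomposition G (suc m) B) (EM : EdgeMaximal G B) where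

  open IsPathDecomposition PD

  -- β is kept opaque so that its argument can be inferred from membership goals.
  opaque
    -- The bag at position p of the path, empty beyond the last node m.
    β : ℕ → Subset n
    β p with p ≤? m
    ... | yes p≤m = B (fromℕ< (s≤s p≤m))
    ... | no _ = ⊥

    β-node : ∀ {p} (p≤m : p ≤ m) → β p ≡ B (fromℕ< (s≤s p≤m))
    β-node {p} p≤m with p ≤? m
    ... | yes _ = refl
    ... | no p≰m = contradiction p≤m p≰m

    β-bound : ∀ {v p} → v ∈ β p → p ≤ m
    β-bound {v} {p} v∈ with p ≤? m
    ... | yes p≤m = p≤m
    ... | no _ = ⊥-elim (∉⊥ v∈)

    β-size : ∀ {k} → (∀ x → ∣ B x ∣ ≤ k) → ∀ p → ∣ β p ∣ ≤ k
    β-size {k} width p with p ≤? m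
    ... | yes _ = width _
    ... | no _ = subst (_≤ k) (sym (∣⊥∣≡0 n)) z≤n

  β-toℕ : ∀ x → β (toℕ x) ≡ B x
  β-toℕ x = trans (β-node (toℕ≤pred[n] x)) (cong B (fromℕ<-toℕ x _))

  ∈β⇒∈B : ∀ {v p} (v∈ : v ∈ β p) → v ∈ B (fromℕ< (s≤s (β-bound v∈)))
  ∈β⇒∈B v∈ = subst (_ ∈_) (β-node (β-bound v∈)) v∈

  ∈B⇒∈β : ∀ {v} x → v ∈ B x → v ∈ β (toℕ x)
  ∈B⇒∈β x v∈ = subst (_ ∈_) (sym (β-toℕ x)) v∈

  β-interval : ∀ {v i j k} → v ∈ β i → v ∈ β k → i ≤ j → j ≤ k → v ∈ β j
  β-interval {v} {i} {j} {k} v∈i v∈k i≤j j≤k =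
    subst (v ∈_) (sym (β-node j≤m))
      (connected v (fromℕ< (s≤s i≤m)) (fromℕ< (s≤s j≤m)) (fromℕ< (s≤s k≤m))
        (subst₂ _≤_ (sym (toℕ-fromℕ< (s≤s i≤m))) (sym (toℕ-fromℕ< (s≤s j≤m))) i≤j)
        (subst₂ _≤_ (sym (toℕ-fromℕ< (s≤s j≤m))) (sym (toℕ-fromℕ< (s≤s k≤m))) j≤k)
        (∈β⇒∈B v∈i) (∈β⇒∈B v∈k))
    where
      k≤m : k ≤ m
      k≤m = β-bound v∈k
      j≤m : j ≤ m
      j≤m = ≤-trans j≤k k≤m
      i≤m : i ≤ m
      i≤m = ≤-trans i≤j j≤m

  β-edge : ∀ {u v} → Adj G u v → ∃ λ p → u ∈ β p × v ∈ β p
  β-edge {u} {v} uv with edges u v uv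
  ... | x , u∈ , v∈ = toℕ x , ∈B⇒∈β x u∈ , ∈B⇒∈β x v∈

  separated : ∀ {u v p} → u ≢ v → ¬ Adj G u v → u ∈ β p → v ∉ β p
  separated {u} {v} u≢v ¬uv u∈ v∈ =
    ¬uv (EM _ u v (∈β⇒∈B u∈) (subst (v ∈_) (β-node (β-bound u∈)) v∈) u≢v)

  separated′ : ∀ {u v p} → u ≢ v → ¬ Adj G u v → v ∈ β p → u ∉ β p
  separated′ u≢v ¬uv = separated (λ v≡u → u≢v (sym v≡u)) (λ vu → ¬uv (Adj-sym G vu))

  pos : Fin n → ℕ
  pos v = toℕ (proj₁ (nonempty v))

  pos-in : ∀ v → v ∈ β (pos v)
  pos-in v = ∈B⇒∈β _ (proj₂ (nonempty v))

  Inside : ℕ → ℕ → Fin n → Set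
  Inside g g' v = v ∉ β g × v ∉ β g' × g < pos v × pos v < g'

  inside? : ∀ g g' → Decidable (Inside g g')
  inside? g g' v with v ∈? β g | v ∈? β g' | g <? pos v | pos v <? g'
  ... | yes v∈g | _ | _ | _ = no λ ins → proj₁ ins v∈g
  ... | no _ | yes v∈g' | _ | _ = no λ ins → proj₁ (proj₂ ins) v∈g'
  ... | no _ | no _ | no g≮p | _ = no λ ins → g≮p (proj₁ (proj₂ (proj₂ ins)))
  ... | no _ | no _ | yes _ | no p≮g' = no λ ins → p≮g' (proj₂ (proj₂ (proj₂ ins)))
  ... | no v∉g | no v∉g' | yes g<p | yes p<g' = yes (v∉g , v∉g' , g<p , p<g')

  inside-bags : ∀ {g g' v y} → Inside g g' v → v ∈ β y → g < y × y < g'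
  inside-bags {g} {g'} {v} {y} (v∉g , v∉g' , g<p , p<g') v∈y with g <? y | y <? g'
  ... | yes g<y | yes y<g' = g<y , y<g'
  ... | no g≮y | _ = ⊥-elim (v∉g (β-interval v∈y (pos-in v) (≮⇒≥ g≮y) (<⇒≤ g<p)))
  ... | yes _ | no y≮g' = ⊥-elim (v∉g' (β-interval (pos-in v) v∈y (<⇒≤ p<g') (≮⇒≥ y≮g')))

  inside-intro : ∀ {g g' v y} → v ∉ β g → v ∉ β g' → v ∈ β y → g < y → y < g' → Inside g g' v
  inside-intro {g} {g'} {v} v∉g v∉g' v∈y g<y y<g' with g <? pos v | pos v <? g'
  ... | yes g<p | yes p<g' = v∉g , v∉g' , g<p , p<g'
  ... | no g≮p | _ = ⊥-elim (v∉g (β-interval (pos-in v) v∈y (≮⇒≥ g≮p) (<⇒≤ g<y)))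
  ... | yes _ | no p≮g' = ⊥-elim (v∉g' (β-interval v∈y (pos-in v) (<⇒≤ y<g') (≮⇒≥ p≮g')))

  outside-neighbour : ∀ {g g' v w} → ¬ Inside g g' v → Adj G v w → Inside g g' w →
    v ∈ β g ⊎ v ∈ β g'
  outside-neighbour {g} {g'} {v} ¬ins vw w-ins with β-edge vw
  ... | y , v∈y , w∈y with v ∈? β g | v ∈? β g'
  ... | yes v∈g | _ = inj₁ v∈g
  ... | no _ | yes v∈g' = inj₂ v∈g'
  ... | no v∉g | no v∉g' =
    let (g<y , y<g') = inside-bags w-ins w∈y in ⊥-elim (¬ins (inside-intro v∉g v∉g' v∈y g<y y<g'))

  module Crossings (ℓ : ℕ) where

    record Segment (g g' r : ℕ) (u : ℕ → Fin n) : Set where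
      field
        walk : IsWalk G r u
        long : 2 ≤ r
        short : r ≤ ℓ
        interior : ∀ c → 0 < c → c < r → Inside g g' (u c)

    record Crossing (g g' : ℕ) : Set where
      field
        r : ℕ
        u : ℕ → Fin n
        segment : Segment g g' r u
        start : u 0 ∈ β g
        start-out : u 0 ∉ β g'
        end : u r ∈ β g'
        end-out : u r ∉ β g
      open Segment segment public

    no-crossing-of-point : ∀ {g} → ¬ Crossing g g
    no-crossing-of-point C with Crossing.interior C 1 (s≤s z≤n) (Crossing.long C)
    ... | _ , _ , g<p , p<g = <-asym g<p p<g

    reverse-segment : ∀ {g g' r u} → Segment g g' r u → Segment g g' r (λ c → u (r ∸ c))
    reverse-segment {r = r} seg = record
      { walk = reverse-walk G walk
      ; long = long
      ; short = short
      ; interior = λ c 0<c c<r → interior (r ∸ c) (m<n⇒0<n∸m c<r) (∸-monoʳ-< 0<c (<⇒≤ c<r))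
      }
      where open Segment seg

    -- A segment whose ends are distinct, non-adjacent and not inside is a crossing,
    -- read in one of its two directions: its ends lie in different end bags.
    segment-crossing : ∀ {g g' r u} → Segment g g' r u → u 0 ≢ u r → ¬ Adj G (u 0) (u r) →
      ¬ Inside g g' (u 0) → ¬ Inside g g' (u r) → Crossing g g'
    segment-crossing {g} {g'} {suc r'} {u} seg u0≢ur ¬adj ¬ins0 ¬insr
      with outside-neighbour ¬ins0 (walk 0 (s≤s z≤n)) (interior 1 (s≤s z≤n) long)
         | outside-neighbour ¬insr (Adj-sym G (walk r' ≤-refl)) (interior r' (≤-pred long) ≤-refl)
      where open Segment seg
    ... | inj₁ u0∈g | inj₂ ur∈g' = record
      { r = suc r' ; u = u ; segment = seg
      ; start = u0∈g ; start-out = separated′ u0≢ur ¬adj ur∈g'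
      ; end = ur∈g' ; end-out = separated u0≢ur ¬adj u0∈g }
    ... | inj₂ u0∈g' | inj₁ ur∈g = record
      { r = suc r' ; u = λ c → u (suc r' ∸ c) ; segment = reverse-segment seg
      ; start = ur∈g ; start-out = separated u0≢ur ¬adj u0∈g'
      ; end = subst (λ c → u c ∈ β g') (sym (n∸n≡0 (suc r'))) u0∈g'
      ; end-out = λ u0∈g →
          separated′ u0≢ur ¬adj ur∈g (subst (λ c → u c ∈ β g) (n∸n≡0 (suc r')) u0∈g) }
    ... | inj₁ u0∈g | inj₁ ur∈g = ⊥-elim (separated u0≢ur ¬adj u0∈g ur∈g)
    ... | inj₂ u0∈g' | inj₂ ur∈g' = ⊥-elim (separated u0≢ur ¬adj u0∈g' ur∈g')

    -- An induced path of length at most ℓ whose ends are not inside (g, g') but which passes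
    -- through an inside vertex contains a crossing: the maximal inside run and its two ends.
    crossing-from-path : ∀ {g g' q W i} → IsInducedWalk G q W → q ≤ ℓ → i ≤ q →
      ¬ Inside g g' (W 0) → ¬ Inside g g' (W q) → Inside g g' (W i) → Crossing g g'
    crossing-from-path {g} {g'} {q} {W} {i} path q≤ℓ i≤q ¬ins0 ¬insq insi =
      segment-crossing segment distinct non-adjacent fails-left fails-right
      where
        open IsInducedWalk path
        open Runs (λ c → inside? g g' (W c))
        run : MaximalRun q i
        run = maximal-run i≤q ¬ins0 ¬insq insi
        open MaximalRun run
        2+j≤r+j : 2 + j ≤ r + j
        2+j≤r+j = ≤-trans (s≤s j<i) i<r+j
        segment : Segment g g' r (λ c → W (c + j))
        segment = record
          { walk = λ c c<r → walk (c + j) (<-≤-trans (+-monoˡ-< j c<r) r+j≤q)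
          ; long = +-cancelʳ-≤ j 2 r 2+j≤r+j
          ; short = ≤-trans (m≤m+n r j) (≤-trans r+j≤q q≤ℓ)
          ; interior = holds
          }
        distinct : W j ≢ W (r + j)
        distinct eq = <-irrefl (injective j (r + j) (≤-trans (m≤n+m j r) r+j≤q) r+j≤q eq)
                               (≤-trans (n≤1+n _) 2+j≤r+j)
        non-adjacent : ¬ Adj G (W j) (W (r + j))
        non-adjacent jr with chordless j (r + j) (≤-trans (m≤n+m j r) r+j≤q) r+j≤q jr
        ... | inj₁ r+j≡1+j = <-irrefl (sym r+j≡1+j) 2+j≤r+j
        ... | inj₂ j≡1+r+j = <-irrefl j≡1+r+j (s≤s (m≤n+m j r))

    Spans : ℕ → ℕ → Fin n → Set
    Spans g g' v = v ∈ β g × v ∈ β g'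

    Excess : ℕ → ℕ → ℕ → Subset n
    Excess g g' p = β p ∩ ∁ (β g ∩ β g')

    excess⁺ : ∀ {g g' p v} → v ∈ β p → ¬ Spans g g' v → v ∈ Excess g g' p
    excess⁺ {g} {g'} v∈p ¬spans =
      x∈p∩q⁺ (v∈p , x∉p⇒x∈∁p λ v∈g∩g' → ¬spans (x∈p∩q⁻ (β g) (β g') v∈g∩g'))

    excess⁻ : ∀ {g g' p v} → v ∈ Excess g g' p → v ∈ β p × ¬ Spans g g' v
    excess⁻ {p = p} v∈ =
      proj₁ (x∈p∩q⁻ (β p) _ v∈) , λ spans → x∈∁p⇒x∉p (proj₂ (x∈p∩q⁻ (β p) _ v∈)) (x∈p∩q⁺ spans)

    ExcessAtMost : ℕ → ℕ → ℕ → Set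
    ExcessAtMost g g' k = ∀ p → g ≤ p → p ≤ g' → ∣ Excess g g' p ∣ ≤ k

    -- With excess at most 1 there is no crossing: the bag of the first edge of a crossing
    -- lies in the gap and contains two distinct non-spanning vertices.
    excess-one-no-crossing : ∀ {g g'} → ExcessAtMost g g' 1 → ¬ Crossing g g'
    excess-one-no-crossing {g} {g'} bound C =
      <⇒≱ (two-elements (excess⁺ u0∈p (λ spans → start-out (proj₂ spans)))
                         (excess⁺ u1∈p (λ spans → proj₁ u1-inside (proj₁ spans)))
                         (λ u0≡u1 → proj₁ u1-inside (subst (_∈ β g) u0≡u1 start)))
          (bound p (<⇒≤ (proj₁ p-inside)) (<⇒≤ (proj₂ p-inside)))
      where
        open Crossing C
        first-edge : ∃ λ p → u 0 ∈ β p × u 1 ∈ β p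
        first-edge = β-edge (walk 0 (≤-trans (s≤s z≤n) long))
        p : ℕ
        p = proj₁ first-edge
        u0∈p : u 0 ∈ β p
        u0∈p = proj₁ (proj₂ first-edge)
        u1∈p : u 1 ∈ β p
        u1∈p = proj₂ (proj₂ first-edge)
        u1-inside : Inside g g' (u 1)
        u1-inside = interior 1 (s≤s z≤n) long
        p-inside : g < p × p < g'
        p-inside = inside-bags u1-inside u1∈p

    -- A vertex c spanning neither (h, h') but lying in β a and β b, for h ≤ a ≤ b ≤ h',
    -- leaves the excess over (a, b) while staying in the excess over (h, h').
    excess-shrinks : ∀ {h h' a b K} → ExcessAtMost h h' (suc K) → h ≤ a → b ≤ h' → a ≤ b →
      (∃ λ c → c ∈ β a × c ∈ β b × ¬ Spans h h' c) → ExcessAtMost a b K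
    excess-shrinks {h} {h'} {a} {b} bound h≤a b≤h' a≤b (c , c∈a , c∈b , ¬spans) p a≤p p≤b =
      ≤-pred (≤-trans (p⊂q⇒∣p∣<∣q∣ (smaller , c , c∈outer , c∉inner))
                      (bound p (≤-trans h≤a a≤p) (≤-trans p≤b b≤h')))
      where
        smaller : Excess a b p ⊆ Excess h h' p
        smaller v∈ = let (v∈p , ¬spans-ab) = excess⁻ v∈ in
          excess⁺ v∈p λ (v∈h , v∈h') →
            ¬spans-ab (β-interval v∈h v∈p h≤a a≤p , β-interval v∈p v∈h' p≤b b≤h')
        c∈outer : c ∈ Excess h h' p
        c∈outer = excess⁺ (β-interval c∈a c∈b a≤p p≤b) ¬spans
        c∉inner : c ∉ Excess a b p
        c∉inner c∈ = proj₂ (excess⁻ c∈) (c∈a , c∈b)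

    module Greedy (h h' : ℕ) where

      Link : ℕ → ℕ → Set
      Link x p = ∃ λ v → v ∈ β x × v ∈ β p × ¬ Spans h h' v

      link? : ∀ x → Decidable (Link x)
      link? x p = any? λ v → (v ∈? β x) ×-dec ((v ∈? β p) ×-dec ¬? ((v ∈? β h) ×-dec (v ∈? β h')))

      next : ℕ → ℕ
      next x = Largest.largest (link? x) x h'

      x≤next : ∀ x → x ≤ next x
      x≤next x = Largest.x≤largest (link? x) x h'

      next-linked : ∀ x → next x ≢ x → Link x (next x)
      next-linked x = Largest.largest-satisfies (link? x) x h'

      next-passes : ∀ x y → y ≤ h' → (x < y → Link x y) → y ≤ next x
      next-passes x y y≤h' link with y ≤? x
      ... | yes y≤x = ≤-trans y≤x (x≤next x)
      ... | no y≰x = Largest.largest-maximal (link? x) x h' y (<⇒≤ (≰⇒> y≰x)) y≤h' (link (≰⇒> y≰x))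

      jump : ℕ → ℕ → ℕ
      jump zero x = x
      jump (suc k) x = next (jump k x)

      jump-shift : ∀ k x → jump (suc k) x ≡ jump k (next x)
      jump-shift zero x = refl
      jump-shift (suc k) x = cong next (jump-shift k x)

      jump≤h' : ∀ k x → x ≤ h' → jump k x ≤ h'
      jump≤h' zero x x≤h' = x≤h'
      jump≤h' (suc k) x x≤h' = Largest.largest≤top (link? _) _ h' (jump≤h' k x x≤h')

      jump-mono : ∀ {a b} x → a ≤ b → jump a x ≤ jump b x
      jump-mono {b = zero} x z≤n = ≤-refl
      jump-mono {a} {suc b} x a≤1+b with m≤n⇒m<n∨m≡n a≤1+b
      ... | inj₁ a<1+b = ≤-trans (jump-mono x (≤-pred a<1+b)) (x≤next (jump b x))
      ... | inj₂ refl = ≤-refl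

      jump-stuck : ∀ k x → next x ≡ x → jump k x ≡ x
      jump-stuck zero x _ = refl
      jump-stuck (suc k) x stuck = trans (cong next (jump-stuck k x stuck)) stuck

      -- Along a crossing of (h, h') the jumps keep pace with the walk, so they reach h'.
      module Follow (h<h' : h < h') (C : Crossing h h') where
        open Crossing C

        bags-before-end : ∀ i → i < r → ∀ {z} → u i ∈ β z → z ≤ h'
        bags-before-end zero _ {z} u0∈z with z ≤? h'
        ... | yes z≤h' = z≤h'
        ... | no z≰h' = ⊥-elim (start-out (β-interval start u0∈z (<⇒≤ h<h') (<⇒≤ (≰⇒> z≰h'))))
        bags-before-end (suc i) i<r ui∈z =
          <⇒≤ (proj₂ (inside-bags (interior (suc i) (s≤s z≤n) i<r) ui∈z))

        non-spanning : ∀ i → i ≤ r → ¬ Spans h h' (u i)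
        non-spanning zero _ (_ , u0∈h') = start-out u0∈h'
        non-spanning (suc i) i<r (ui∈h , _) with m≤n⇒m<n∨m≡n i<r
        ... | inj₁ i<r = proj₁ (interior (suc i) (s≤s z≤n) i<r) ui∈h
        ... | inj₂ refl = end-out ui∈h

        follows : ∀ i → i ≤ r → ∀ y → y ≤ h' → u i ∈ β y → y ≤ jump (suc i) h
        follows zero _ y y≤h' u0∈y =
          next-passes h y y≤h' λ _ → u 0 , start , u0∈y , non-spanning 0 z≤n
        follows (suc i) i<r y y≤h' ui∈y =
          next-passes X y y≤h' λ X<y →
            u (suc i) , β-interval usi∈z ui∈y z≤X (<⇒≤ X<y) , ui∈y , non-spanning (suc i) i<r
          where
            X : ℕ
            X = jump (suc i) h
            edge : ∃ λ z → u i ∈ β z × u (suc i) ∈ β z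
            edge = β-edge (walk i i<r)
            usi∈z : u (suc i) ∈ β (proj₁ edge)
            usi∈z = proj₂ (proj₂ edge)
            z≤X : proj₁ edge ≤ X
            z≤X = follows i (<⇒≤ i<r) (proj₁ edge)
                    (bags-before-end i i<r (proj₁ (proj₂ edge))) (proj₁ (proj₂ edge))

        reached : jump (suc ℓ) h ≡ h'
        reached = ≤-antisym (jump≤h' (suc ℓ) h (<⇒≤ h<h'))
                    (≤-trans (follows r ≤-refl h' ≤-refl end) (jump-mono h (s≤s short)))

      Step : ℕ → ℕ → Set
      Step x p = x < p × Link x p

      Steps : ℕ → List ℕ → Set
      Steps x [] = Step x h'
      Steps x (e ∷ es) = Step x e × Steps e es

      next-step : ∀ x → x < next x → Step x (next x)
      next-step x x<next = x<next , next-linked x (λ next≡x → <-irrefl (sym next≡x) x<next)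

      stops : ℕ → ℕ → Maybe (List ℕ)
      stops x f with x <? next x | next x ≟ h' | f
      ... | no _ | _ | _ = nothing
      ... | yes _ | yes _ | _ = just []
      ... | yes _ | no _ | zero = nothing
      ... | yes _ | no _ | suc f' = Maybe.map (next x ∷_) (stops (next x) f')

      stops-just : ∀ f x es → stops x f ≡ just es → Steps x es × length es ≤ f
      stops-just f x es eq with x <? next x | next x ≟ h' | f
      stops-just f x .[] refl | yes x<next | yes next≡h' | _ =
        subst (Step x) next≡h' (next-step x x<next) , z≤n
      stops-just f x es eq | yes x<next | no _ | suc f' with stops (next x) f' in eq'
      stops-just f x .(next x ∷ es') refl | yes x<next | no _ | suc f' | just es' =
        let (steps , len) = stops-just f' (next x) es' eq' in (next-step x x<next , steps) , s≤s len

      stops-nothing : ∀ f x → x < h' → stops x f ≡ nothing → jump (suc f) x ≢ h'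
      stops-nothing f x x<h' eq with x <? next x | next x ≟ h' | f
      ... | no x≮next | _ | f' = λ jump≡h' →
        <-irrefl (trans (sym (jump-stuck (suc f') x stuck)) jump≡h') x<h'
        where
          stuck : next x ≡ x
          stuck = ≤-antisym (≮⇒≥ x≮next) (x≤next x)
      ... | yes _ | no next≢h' | zero = next≢h'
      ... | yes _ | no next≢h' | suc f' with stops (next x) f' in eq'
      ...   | nothing = λ jump≡h' → stops-nothing f' (next x)
                           (≤∧≢⇒< (Largest.largest≤top (link? x) x h' (<⇒≤ x<h')) next≢h') eq'
                           (trans (sym (jump-shift (suc f') x)) jump≡h')

    record Leaf (h : ℕ) (L : List ℕ) (h' p : ℕ) : Set where
      field
        g g' : ℕ
        g-cut : g ≡ h ⊎ g ∈ₗ L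
        g'-cut : g' ≡ h' ⊎ g' ∈ₗ L
        g<p : g < p
        p<g' : p < g'
        consecutive : ∀ s → s ∈ₗ L → s ≤ g ⊎ g' ≤ s
        no-crossing : ¬ Crossing g g'

    InsideLeaf : ∀ {h L h' p} → Leaf h L h' p → Fin n → Set
    InsideLeaf leaf = Inside (Leaf.g leaf) (Leaf.g' leaf)

    record Good (h : ℕ) (L : List ℕ) (h' : ℕ) : Set where
      field
        between : ∀ s → s ∈ₗ L → h < s × s < h'
        leaf : ∀ p → h < p → p < h' → p ∉ₗ L → Leaf h L h' p

    good-[] : ∀ {h h'} → ¬ Crossing h h' → Good h [] h'
    good-[] {h} {h'} no-crossing = record
      { between = λ _ ()
      ; leaf = λ p h<p p<h' _ → record
          { g = h ; g' = h' ; g-cut = inj₁ refl ; g'-cut = inj₁ refl ; g<p = h<p ; p<g' = p<h'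
          ; consecutive = λ _ () ; no-crossing = no-crossing }
      }

    leaf-left : ∀ {h e h' L₁ L₂ p} → Good h L₁ e → Good e L₂ h' → Leaf h L₁ e p →
      Leaf h (L₁ ++ e ∷ L₂) h' p
    leaf-left {h} {e} {h'} {L₁} {L₂} good₁ good₂ leaf = record
      { g = g ; g' = g' ; g<p = g<p ; p<g' = p<g' ; no-crossing = no-crossing
      ; g-cut = Sum.map₂ ∈-++⁺ˡ g-cut
      ; g'-cut = inj₂ (Sum.[ (λ g'≡e → subst (_∈ₗ _) (sym g'≡e) e-in) , ∈-++⁺ˡ ]′ g'-cut)
      ; consecutive = consecutive′
      }
      where
        open Leaf leaf
        e-in : e ∈ₗ L₁ ++ e ∷ L₂
        e-in = ∈-++⁺ʳ L₁ (here refl)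
        g'≤e : g' ≤ e
        g'≤e = Sum.[ ≤-reflexive , (λ g'∈ → <⇒≤ (proj₂ (Good.between good₁ g' g'∈))) ]′ g'-cut
        consecutive′ : ∀ s → s ∈ₗ L₁ ++ e ∷ L₂ → s ≤ g ⊎ g' ≤ s
        consecutive′ s s∈ with ∈-++⁻ L₁ s∈
        ... | inj₁ s∈L₁ = consecutive s s∈L₁
        ... | inj₂ (here refl) = inj₂ g'≤e
        ... | inj₂ (there s∈L₂) = inj₂ (≤-trans g'≤e (<⇒≤ (proj₁ (Good.between good₂ s s∈L₂))))

    leaf-right : ∀ {h e h' L₁ L₂ p} → Good h L₁ e → Good e L₂ h' → Leaf e L₂ h' p →
      Leaf h (L₁ ++ e ∷ L₂) h' p
    leaf-right {h} {e} {h'} {L₁} {L₂} good₁ good₂ leaf = record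
      { g = g ; g' = g' ; g<p = g<p ; p<g' = p<g' ; no-crossing = no-crossing
      ; g-cut = inj₂ (Sum.[ (λ g≡e → subst (_∈ₗ _) (sym g≡e) (∈-++⁺ʳ L₁ (here refl))) , in-L₂ ]′
                           g-cut)
      ; g'-cut = Sum.map₂ in-L₂ g'-cut
      ; consecutive = consecutive′
      }
      where
        open Leaf leaf
        in-L₂ : ∀ {s} → s ∈ₗ L₂ → s ∈ₗ L₁ ++ e ∷ L₂
        in-L₂ s∈ = ∈-++⁺ʳ L₁ (there s∈)
        e≤g : e ≤ g
        e≤g = Sum.[ (λ g≡e → ≤-reflexive (sym g≡e)) , (λ g∈ → <⇒≤ (proj₁ (Good.between good₂ g g∈))) ]′
                g-cut
        consecutive′ : ∀ s → s ∈ₗ L₁ ++ e ∷ L₂ → s ≤ g ⊎ g' ≤ s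
        consecutive′ s s∈ with ∈-++⁻ L₁ s∈
        ... | inj₁ s∈L₁ = inj₁ (≤-trans (<⇒≤ (proj₂ (Good.between good₁ s s∈L₁))) e≤g)
        ... | inj₂ (here refl) = inj₁ e≤g
        ... | inj₂ (there s∈L₂) = consecutive s s∈L₂

    good-++ : ∀ {h e h' L₁ L₂} → h < e → e < h' → Good h L₁ e → Good e L₂ h' →
      Good h (L₁ ++ e ∷ L₂) h'
    good-++ {h} {e} {h'} {L₁} {L₂} h<e e<h' good₁ good₂ = record { between = between ; leaf = leaf }
      where
        between : ∀ s → s ∈ₗ L₁ ++ e ∷ L₂ → h < s × s < h'
        between s s∈ with ∈-++⁻ L₁ s∈
        ... | inj₁ s∈L₁ = let (h<s , s<e) = Good.between good₁ s s∈L₁ in h<s , <-trans s<e e<h'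
        ... | inj₂ (here refl) = h<e , e<h'
        ... | inj₂ (there s∈L₂) =
          let (e<s , s<h') = Good.between good₂ s s∈L₂ in <-trans h<e e<s , s<h'
        leaf : ∀ p → h < p → p < h' → p ∉ₗ L₁ ++ e ∷ L₂ → Leaf h (L₁ ++ e ∷ L₂) h' p
        leaf p h<p p<h' p∉ with <-cmp p e
        ... | tri< p<e _ _ =
          leaf-left good₁ good₂ (Good.leaf good₁ p h<p p<e (λ p∈ → p∉ (∈-++⁺ˡ p∈)))
        ... | tri≈ _ p≡e _ = ⊥-elim (p∉ (∈-++⁺ʳ L₁ (here p≡e)))
        ... | tri> _ _ e<p =
          leaf-right good₁ good₂ (Good.leaf good₂ p e<p p<h' (λ p∈ → p∉ (∈-++⁺ʳ L₁ (there p∈))))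

    chain : (ℕ → ℕ → List ℕ) → ℕ → List ℕ → ℕ → List ℕ
    chain F x [] h' = F x h'
    chain F x (e ∷ es) h' = F x e ++ e ∷ chain F e es h'

    refine : ℕ → ℕ → ℕ → List ℕ
    refine zero h h' = []
    refine (suc k) h h' with Greedy.stops h h' h ℓ
    ... | nothing = []
    ... | just es = chain (refine k) h es h'

    steps-below : ∀ {h h' x} es → Greedy.Steps h h' x es → x < h'
    steps-below [] (x<h' , _) = x<h'
    steps-below (e ∷ es) ((x<e , _) , steps) = <-trans x<e (steps-below es steps)

    -- Refining every gap between consecutive greedy stops, whose excess has dropped, is good.
    chain-good : ∀ k h h' → ExcessAtMost h h' (suc (suc k)) →
      (∀ a b → a ≤ b → ExcessAtMost a b (suc k) → Good a (refine k a b) b) →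
      ∀ x es → h ≤ x → Greedy.Steps h h' x es → Good x (chain (refine k) x es h') h'
    chain-good k h h' bound good-k x [] h≤x (x<h' , link) =
      good-k x h' (<⇒≤ x<h') (excess-shrinks bound h≤x ≤-refl (<⇒≤ x<h') link)
    chain-good k h h' bound good-k x (e ∷ es) h≤x ((x<e , link) , steps) =
      good-++ x<e e<h'
        (good-k x e (<⇒≤ x<e) (excess-shrinks bound h≤x (<⇒≤ e<h') (<⇒≤ x<e) link))
        (chain-good k h h' bound good-k e es (≤-trans h≤x (<⇒≤ x<e)) steps)
      where
        e<h' : e < h'
        e<h' = steps-below es steps

    refine-good : ∀ k h h' → h ≤ h' → ExcessAtMost h h' (suc k) → Good h (refine k h h') h'
    refine-good zero h h' _ bound = good-[] (excess-one-no-crossing bound)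
    refine-good (suc k) h h' h≤h' bound with Greedy.stops h h' h ℓ in eq
    ... | just es = chain-good k h h' bound (λ a b a≤b → refine-good k a b a≤b) h es ≤-refl
                      (proj₁ (Greedy.stops-just h h' ℓ h es eq))
    ... | nothing with m≤n⇒m<n∨m≡n h≤h'
    ...   | inj₁ h<h' = good-[] λ C →
              Greedy.stops-nothing h h' ℓ h h<h' eq (Greedy.Follow.reached h h' h<h' C)
    ...   | inj₂ refl = good-[] no-crossing-of-point

    R : ℕ → ℕ
    R zero = 0
    R (suc k) = ℓ + suc ℓ * R k

    chain-length : ∀ (F : ℕ → ℕ → List ℕ) K → (∀ a b → length (F a b) ≤ K) →
      ∀ x es h' → length (chain F x es h') ≤ length es + suc (length es) * K
    chain-length F K bound x [] h' = subst (length (F x h') ≤_) (sym (+-identityʳ K)) (bound x h')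
    chain-length F K bound x (e ∷ es) h' = begin
      length (F x e ++ e ∷ chain F e es h')           ≡⟨ length-++ (F x e) ⟩
      length (F x e) + suc (length (chain F e es h'))
        ≤⟨ +-mono-≤ (bound x e) (s≤s (chain-length F K bound e es h')) ⟩
      K + suc (length es + suc (length es) * K)        ≡⟨ regroup K (length es) ⟩
      suc (length es) + suc (suc (length es)) * K      ∎
      where
        open ≤-Reasoning
        regroup : ∀ K a → K + suc (a + suc a * K) ≡ suc a + suc (suc a) * K
        regroup = solve-∀

    refine-length : ∀ k h h' → length (refine k h h') ≤ R k
    refine-length zero h h' = z≤n
    refine-length (suc k) h h' with Greedy.stops h h' h ℓ in eq
    ... | nothing = z≤n
    ... | just es =
      let few = proj₂ (Greedy.stops-just h h' ℓ h es eq) in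
      ≤-trans (chain-length (refine k) (R k) (refine-length k) h es h')
        (+-mono-≤ few (*-monoˡ-≤ (R k) (s≤s few)))

    -- With ℓ ≥ 1, R k + 1 = (ℓ + 1)^k ≤ (2ℓ)^k.
    R-bound : 1 ≤ ℓ → ∀ k → suc (R k) ≤ 2 ^ k * ℓ ^ k
    R-bound 1≤ℓ zero = ≤-refl
    R-bound 1≤ℓ (suc k) = begin
      suc (ℓ + suc ℓ * R k)     ≡⟨ factor ℓ (R k) ⟩
      suc ℓ * suc (R k)         ≤⟨ *-mono-≤ 1+ℓ≤2ℓ (R-bound 1≤ℓ k) ⟩
      (2 * ℓ) * (2 ^ k * ℓ ^ k) ≡⟨ regroup ℓ (2 ^ k) (ℓ ^ k) ⟩
      (2 * 2 ^ k) * (ℓ * ℓ ^ k) ∎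
      where
        open ≤-Reasoning
        factor : ∀ l r → suc (l + suc l * r) ≡ suc l * suc r
        factor = solve-∀
        regroup : ∀ l a b → (2 * l) * (a * b) ≡ (2 * a) * (l * b)
        regroup = solve-∀
        1+ℓ≤2ℓ : suc ℓ ≤ 2 * ℓ
        1+ℓ≤2ℓ = ≤-trans (+-monoˡ-≤ ℓ 1≤ℓ) (≤-reflexive (cong (ℓ +_) (sym (+-identityʳ ℓ))))

    module Cover (t : ℕ) (width : ∀ x → ∣ B x ∣ ≤ suc t) where

      L : List ℕ
      L = refine t 0 m

      cuts : List ℕ
      cuts = 0 ∷ m ∷ L

      U : Subset n
      U = ⋃ (map β cuts)

      -- Initially every bag has excess at most t + 1, its size.
      good : Good 0 L m
      good = refine-good t 0 m z≤n (λ p _ _ → ≤-trans (∣p∩q∣≤∣p∣ (β p) _) (β-size width p))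

      U-ends : (B zero ∪ B (fromℕ m)) ⊆ U
      U-ends {v} v∈ with x∈p∪q⁻ (B zero) (B (fromℕ m)) v∈
      ... | inj₁ v∈first = ∈-⋃-map⁺ β cuts (here refl) (∈B⇒∈β zero v∈first)
      ... | inj₂ v∈last = ∈-⋃-map⁺ β cuts (there (here refl))
                            (subst (λ p → v ∈ β p) (toℕ-fromℕ m) (∈B⇒∈β (fromℕ m) v∈last))

      -- U has at most (R t + 2)(t + 1) ≤ (t + 1) 2^(t+1) ℓ^t vertices.
      U-size : 1 ≤ ℓ → ∣ U ∣ ≤ suc t * (2 * 2 ^ t) * ℓ ^ t
      U-size 1≤ℓ = begin
        ∣ U ∣                               ≤⟨ ∣⋃-map∣≤ β (β-size width) cuts ⟩
        (2 + length L) * suc t              ≤⟨ *-monoˡ-≤ (suc t) (+-monoʳ-≤ 2 (refine-length t 0 m)) ⟩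
        (2 + R t) * suc t                   ≤⟨ *-monoˡ-≤ (suc t) (+-monoʳ-≤ 2 (m≤m+n (R t) (R t))) ⟩
        (2 + (R t + R t)) * suc t           ≡⟨ double (R t) (suc t) ⟩
        2 * suc (R t) * suc t               ≤⟨ *-monoˡ-≤ (suc t) (*-monoʳ-≤ 2 (R-bound 1≤ℓ t)) ⟩
        2 * (2 ^ t * ℓ ^ t) * suc t         ≡⟨ regroup (suc t) (2 ^ t) (ℓ ^ t) ⟩
        suc t * (2 * 2 ^ t) * ℓ ^ t         ∎
        where
          open ≤-Reasoning
          double : ∀ r s → (2 + (r + r)) * s ≡ 2 * suc r * s
          double = solve-∀
          regroup : ∀ s a b → 2 * (a * b) * s ≡ s * (2 * a) * b
          regroup = solve-∀

      -- The bags at cut points bound the leaf gaps, so their vertices are never inside one.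
      cut-not-inside : ∀ {p v} (leaf : Leaf 0 L m p) → v ∈ U → ¬ InsideLeaf leaf v
      cut-not-inside leaf v∈U ins with ∈-⋃-map⁻ β cuts v∈U
      ... | s , s∈cuts , v∈s with inside-bags ins v∈s | s∈cuts
      ...   | g<s , _ | here refl = <-irrefl refl (<-≤-trans g<s z≤n)
      ...   | _ , s<g' | there (here refl) = <-irrefl refl (<-≤-trans s<g' g'≤m)
        where
          g'≤m : Leaf.g' leaf ≤ m
          g'≤m = Sum.[ ≤-reflexive , (λ g'∈ → <⇒≤ (proj₂ (Good.between good _ g'∈))) ]′
                   (Leaf.g'-cut leaf)
      ...   | g<s , s<g' | there (there s∈L) with Leaf.consecutive leaf s s∈L
      ...     | inj₁ s≤g = <-irrefl refl (<-≤-trans g<s s≤g)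
      ...     | inj₂ g'≤s = <-irrefl refl (<-≤-trans s<g' g'≤s)

      leaf-around : ∀ {v} → v ∉ U → Σ (Leaf 0 L m (pos v)) λ leaf → InsideLeaf leaf v
      leaf-around {v} v∉U =
        leaf , inside-intro (not-at-cut g-cut′) (not-at-cut g'-cut′) (pos-in v) g<p p<g'
        where
          not-at-cut : ∀ {s} → s ∈ₗ cuts → v ∉ β s
          not-at-cut s∈ v∈s = v∉U (∈-⋃-map⁺ β cuts s∈ v∈s)
          at : ∀ {s} → pos v ≡ s → v ∈ β s
          at pos≡s = subst (λ s → v ∈ β s) pos≡s (pos-in v)
          0<p : 0 < pos v
          0<p = ≤∧≢⇒< z≤n (λ 0≡p → not-at-cut (here refl) (at (sym 0≡p)))
          p<m : pos v < m
          p<m = ≤∧≢⇒< (β-bound (pos-in v)) (λ p≡m → not-at-cut (there (here refl)) (at p≡m))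
          leaf : Leaf 0 L m (pos v)
          leaf = Good.leaf good (pos v) 0<p p<m (λ p∈L → not-at-cut (there (there p∈L)) (pos-in v))
          open Leaf leaf
          g-cut′ : g ∈ₗ cuts
          g-cut′ = Sum.[ here , (λ g∈L → there (there g∈L)) ]′ g-cut
          g'-cut′ : g' ∈ₗ cuts
          g'-cut′ = Sum.[ (λ g'≡m → there (here g'≡m)) , (λ g'∈L → there (there g'∈L)) ]′ g'-cut

      -- U is closed under short induced paths: a vertex outside U would be inside a
      -- crossing-free gap, while the ends of the path are not, giving a crossing.
      U-closed : ∀ q (w : Fin (suc q) → Fin n) → q ≤ ℓ → IsInducedPath G q w →
        w zero ∈ U → w (fromℕ q) ∈ U → ∀ i → w i ∈ U
      U-closed q w q≤ℓ path w0∈U wq∈U i with w i ∈? U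
      ... | yes wi∈U = wi∈U
      ... | no wi∉U =
        let (leaf , wi-inside) = leaf-around wi∉U in ⊥-elim (Leaf.no-crossing leaf
             (crossing-from-path (induced-walk path) q≤ℓ (toℕ≤pred[n] i)
               (cut-not-inside leaf (subst (_∈ U) (cong w (sym (toFin-toℕ zero))) w0∈U))
               (cut-not-inside leaf (subst (_∈ U) (cong w (sym last-position)) wq∈U))
               (subst (Inside _ _) (cong w (sym (toFin-toℕ i))) wi-inside)))
        where
          last-position : toFin q q ≡ fromℕ q
          last-position = trans (cong (toFin q) (sym (toℕ-fromℕ q))) (toFin-toℕ (fromℕ q))

lemma25 : ∀ (t : ℕ) → ∃ λ (C : ℕ) → ∀ (ℓ : ℕ) → 1 ≤ ℓ →
    ∀ (m n : ℕ) (G : Graph n) (B : Fin (suc m) → Subset n) →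
    IsPathDecomposition G (suc m) B → HasWidth B t → EdgeMaximal G B →
    ∃ λ (U : Subset n) →
      ((B zero ∪ B (fromℕ m)) ⊆ U) ×
      (∣ U ∣ ≤ C * ℓ ^ t) ×
      (∀ (q : ℕ) (w : Fin (suc q) → Fin n) → 1 ≤ q → q ≤ ℓ → IsInducedPath G q w →
        w zero ∈ U → w (fromℕ q) ∈ U →
        ∀ (i : Fin (suc q)) → 0 < toℕ i → toℕ i < q → w i ∈ U)
lemma25 t = suc t * (2 * 2 ^ t) , λ ℓ 1≤ℓ m n G B PD (width , _) EM →
  let open Decomposition G B PD EM
      open Crossings ℓ
      open Cover t width
  in U , U-ends , U-size 1≤ℓ ,
     λ q w _ q≤ℓ path w0∈U wq∈U i _ _ → U-closed q w q≤ℓ path w0∈U wq∈U i
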